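{- The sequences $\mathbf{t}_{3/2}$ and $\mathbf{t}'$ are uniformly recurrent.
   Context: Let $\mathbf{t}_{3/2}=(t_n)_{n\ge0}\in\{0,1\}^{\mathbb{N}}$ be the unique binary sequence with $t_0=0$ such that $t_{3n}=t_{3n+1}=t_{2n}$ and $t_{3n+2}=1-t_{2n+1}$ for all $n\ge0$ (the Thue--Morse word in base $3/2$; it is the fixed point starting with $0$ of the $2$-block substitution $00\mapsto 001,\ 01\mapsto 000,\ 10\mapsto 111,\ 11\mapsto 110$, applied to consecutive non-overlapping length-$2$ blocks). Let $\mathbf{t}'=(t'_n)_{n\ge0}$ be Dekking's sequence: the unique binary sequence starting with $0$ that is a fixed point of the $2$-block substitution $00\mapsto 010,\ 01\mapsto 010,\ 10\mapsto 101,\ 11\mapsto 101$, i.e. $\mathbf{t}'=\beta(t'_0t'_1)\beta(t'_2t'_3)\cdots$ where $\beta$ denotes this map; it begins $0100101011011010101011011\cdots$. An infinite word is uniformly recurrent if every finite factor of it occurs infinitely often, with bounded gaps between consecutive occurrences. -}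

module Defs where

open import Data.Bool using (Bool; true; false; not)
open import Data.Nat using (ℕ; zero; suc; _+_; _*_; _≤_; _<_)
open import Data.Fin using (Fin; toℕ)
open import Data.Product using (Σ; ∃; _×_; _,_)
open import Relation.Binary.PropositionalEquality using (_≡_)

-- infinite binary words (0 = false, 1 = true)
Word : Set
Word = ℕ → Bool

SameFactor : Word → ℕ → ℕ → ℕ → Set
SameFactor x i j n = ∀ k → k < n → x (j + k) ≡ x (i + k)

UniformlyRecurrent : Word → Set
UniformlyRecurrent x =
  ∀ i n → ∃ λ B → ∀ m → ∃ λ j → (m ≤ j) × (j ≤ m + B) × SameFactor x i j n

IsT32 : Word → Set
IsT32 t =
  (t 0 ≡ false) ×
  (∀ n → (t (3 * n) ≡ t (2 * n)) × (t (3 * n + 1) ≡ t (2 * n))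
         × (t (3 * n + 2) ≡ not (t (2 * n + 1))))

-- Dekking's 2-block substitution  00↦010, 01↦010, 10↦101, 11↦101
β : Bool → Bool → Fin 3 → Bool
β false false Fin.zero = false
β false false (Fin.suc Fin.zero) = true
β false false (Fin.suc (Fin.suc Fin.zero)) = false
β false true Fin.zero = false
β false true (Fin.suc Fin.zero) = true
β false true (Fin.suc (Fin.suc Fin.zero)) = false
β true false Fin.zero = true
β true false (Fin.suc Fin.zero) = false
β true false (Fin.suc (Fin.suc Fin.zero)) = true
β true true Fin.zero = true
β true true (Fin.suc Fin.zero) = false
β true true (Fin.suc (Fin.suc Fin.zero)) = true

-- x starts with 0 and x = β(x0 x1) β(x2 x3) ⋯
IsDekking : Word → Set
IsDekking x =
  (x 0 ≡ false) ×
  (∀ k (j : Fin 3) → x (3 * k + toℕ j) ≡ β (x (2 * k)) (x (2 * k + 1)) j)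

module Submission where

open import Defs
open import Data.Bool using (Bool; true; false; not; _xor_)
open import Data.Bool.Properties using (xor-assoc; xor-identityʳ)
open import Data.Nat using (ℕ; zero; suc; _+_; _*_; _^_; _∸_; _≤_; _<_; z≤n; s≤s; s≤s⁻¹; NonZero; pred)
open import Data.Nat.Properties
open import Data.Nat.DivMod using (_/_; _%_; m≡m%n+[m/n]*n; m%n<n; m/n*n≤m)
open import Data.Nat.Tactic.RingSolver using (solve-∀)
open import Data.Fin using (Fin; toℕ; zero; suc)
open import Data.Product using (∃; _×_; _,_; proj₁; proj₂)
open import Relation.Binary.PropositionalEquality using (_≡_; refl; sym; trans; cong; cong₂; module ≡-Reasoning)
import Algebra.Properties.CommutativeSemigroup as CommutativeSemigroupProperties

module +-Props = CommutativeSemigroupProperties +-commutativeSemigroup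
module *-Props = CommutativeSemigroupProperties *-commutativeSemigroup

-- Both words obey a rule s (3k + r) = c_r ⊕ s (2k + e_r). By induction on j, translating
-- a position n ≤ j by a multiple P of 3^j adds s P to its letter modulo 2, because the
-- translate of n has the translate of its parent (by a multiple of 3^(j-1)) as parent.
-- Since also s (2^j y) = s (3^j y) and 3^(2^m) ≡ 1 mod 2^(m+1), some multiple P of 3^j
-- has s P = 1, so the factor at i reappears complemented at i + P. In every window of
-- length 3^J (J large) a multiple X of 3^J then carries either the factor at i or its
-- complement at i + P back to a copy of the factor at i.

3^2^m≡1+2^[1+m]*c : ∀ m → ∃ λ c → 3 ^ (2 ^ m) ≡ 1 + 2 ^ suc m * c
3^2^m≡1+2^[1+m]*c zero = 1 , refl
3^2^m≡1+2^[1+m]*c (suc m) with c , eq ← 3^2^m≡1+2^[1+m]*c m =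
  c + 2 ^ m * c * c , (begin
    3 ^ (2 * 2 ^ m)              ≡⟨ cong (3 ^_) (*-comm 2 (2 ^ m)) ⟩
    3 ^ (2 ^ m * 2)              ≡⟨ ^-*-assoc 3 (2 ^ m) 2 ⟨
    (3 ^ (2 ^ m)) ^ 2            ≡⟨ cong (_^ 2) eq ⟩
    (1 + 2 * 2 ^ m * c) ^ 2      ≡⟨ square (2 ^ m) c ⟩
    1 + 2 * (2 * 2 ^ m) * (c + 2 ^ m * c * c) ∎)
  where
  open ≡-Reasoning
  square : ∀ a c → (1 + 2 * a * c) * ((1 + 2 * a * c) * 1) ≡ 1 + 2 * (2 * a) * (c + a * c * c)
  square = solve-∀

n<2^n : ∀ n → n < 2 ^ n
n<2^n zero = s≤s z≤n
n<2^n (suc n) = +-mono-≤-< (m^n>0 2 n) (<-≤-trans (n<2^n n) (m≤m+n (2 ^ n) 0))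

multiple-in-window : ∀ m d .{{_ : NonZero d}} → ∃ λ q → m ≤ d * q × d * q ≤ m + d
multiple-in-window m d = suc (m / d) , lower , upper
  where
  open ≤-Reasoning
  lower : m ≤ d * suc (m / d)
  lower = begin
    m                 ≡⟨ m≡m%n+[m/n]*n m d ⟩
    m % d + m / d * d ≤⟨ +-monoˡ-≤ (m / d * d) (<⇒≤ (m%n<n m d)) ⟩
    suc (m / d) * d   ≡⟨ *-comm (suc (m / d)) d ⟩
    d * suc (m / d)   ∎
  upper : d * suc (m / d) ≤ m + d
  upper = begin
    d * suc (m / d)   ≡⟨ *-comm d (suc (m / d)) ⟩
    d + m / d * d     ≤⟨ +-monoʳ-≤ d (m/n*n≤m m d) ⟩
    d + m             ≡⟨ +-comm d m ⟩
    m + d             ∎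

∃n+3^2^[n+j]*x≡2^j*y : ∀ n j → ∃ λ x → ∃ λ y → n + 3 ^ (2 ^ (n + j)) * x ≡ 2 ^ j * y
∃n+3^2^[n+j]*x≡2^j*y n j with c , eq ← 3^2^m≡1+2^[1+m]*c (n + j) =
  n * p , n + 2 ^ suc n * c * n * p , (begin
    n + 3 ^ (2 ^ (n + j)) * (n * p)               ≡⟨ cong (λ a → n + a * (n * p)) eq ⟩
    n + (1 + 2 ^ (suc n + j) * c) * (n * p)       ≡⟨ cong (λ a → n + (1 + a * c) * (n * p)) (^-distribˡ-+-* 2 (suc n) j) ⟩
    n + (1 + 2 ^ suc n * 2 ^ j * c) * (n * p)     ≡⟨ cong (λ a → n + (1 + 2 ^ suc n * a * c) * (n * p)) (suc-pred (2 ^ j)) ⟨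
    n + (1 + 2 ^ suc n * suc p * c) * (n * p)     ≡⟨ factor n (2 ^ suc n) p c ⟩
    suc p * (n + 2 ^ suc n * c * n * p)           ≡⟨ cong (_* (n + 2 ^ suc n * c * n * p)) (suc-pred (2 ^ j)) ⟩
    2 ^ j * (n + 2 ^ suc n * c * n * p)           ∎)
  where
  open ≡-Reasoning
  instance
    2^j≢0 : NonZero (2 ^ j)
    2^j≢0 = m^n≢0 2 j
  p : ℕ
  p = pred (2 ^ j)
  factor : ∀ n a p c → n + (1 + a * suc p * c) * (n * p) ≡ suc p * (n + a * c * n * p)
  factor = solve-∀

next : ℕ × Fin 3 → ℕ × Fin 3
next (k , zero) = k , suc zero
next (k , suc zero) = k , suc (suc zero)
next (k , suc (suc zero)) = suc k , zero

divMod3 : ℕ → ℕ × Fin 3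
divMod3 zero = 0 , zero
divMod3 (suc n) = next (divMod3 n)

divMod3-correct : ∀ n → 3 * proj₁ (divMod3 n) + toℕ (proj₂ (divMod3 n)) ≡ n
divMod3-correct zero = refl
divMod3-correct (suc n) with divMod3 n | divMod3-correct n
... | k , zero | refl = +-suc (3 * k) 0
... | k , suc zero | refl = +-suc (3 * k) 1
... | k , suc (suc zero) | refl = carry k
  where
  carry : ∀ k → 3 * suc k + 0 ≡ suc (3 * k + 2)
  carry = solve-∀

divMod3-3k+r : ∀ k r → divMod3 (3 * k + toℕ r) ≡ (k , r)
divMod3-3k+r zero zero = refl
divMod3-3k+r zero (suc zero) = refl
divMod3-3k+r zero (suc (suc zero)) = refl
divMod3-3k+r (suc k) r = begin
  divMod3 (3 * suc k + toℕ r)                   ≡⟨ cong divMod3 (three-more k (toℕ r)) ⟩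
  next (next (next (divMod3 (3 * k + toℕ r)))) ≡⟨ cong (λ x → next (next (next x))) (divMod3-3k+r k r) ⟩
  next (next (next (k , r)))                   ≡⟨ next³ r ⟩
  suc k , r                                    ∎
  where
  open ≡-Reasoning
  three-more : ∀ k r → 3 * suc k + r ≡ 3 + (3 * k + r)
  three-more = solve-∀
  next³ : ∀ r → next (next (next (k , r))) ≡ (suc k , r)
  next³ zero = refl
  next³ (suc zero) = refl
  next³ (suc (suc zero)) = refl

XorShift : Word → ℕ → ℕ → Set
XorShift s j P = ∀ n → n ≤ j → s (n + P) ≡ s n xor s P

xorShift-factor : ∀ s {j P} i {n} → XorShift s j P → i + n ≤ j →
                  ∀ k → k < n → s (i + P + k) ≡ s (i + k) xor s P
xorShift-factor s {P = P} i shift i+n≤j k k<n =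
  trans (cong s (+-Props.xy∙z≈xz∙y i P k)) (shift (i + k) (≤-trans (+-monoʳ-≤ i (<⇒≤ k<n)) i+n≤j))

xorShifts⇒uniformlyRecurrent : ∀ s →
  (∀ j → ∃ λ d → NonZero d × (∀ q → XorShift s j (d * q)) × ∃ λ q → s (d * q) ≡ true) →
  UniformlyRecurrent s
xorShifts⇒uniformlyRecurrent s periods i n
  with d₁ , _ , shift₁ , q₁ , s[Y]≡1 ← periods (i + n)
  with d , d≢0 , shift , _ ← periods (i + d₁ * q₁ + n)
  = d + i′ , occurrence
  where
  i′ : ℕ
  i′ = i + d₁ * q₁

  flipped : ∀ k → k < n → s (i′ + k) ≡ s (i + k) xor true
  flipped k k<n = trans (xorShift-factor s i (shift₁ q₁) ≤-refl k k<n) (cong (s (i + k) xor_) s[Y]≡1)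

  occurrenceAt : ∀ {m X} b → b ≤ i′ → m ≤ X → X ≤ m + d → SameFactor s i (b + X) n →
                 ∃ λ j → m ≤ j × j ≤ m + (d + i′) × SameFactor s i j n
  occurrenceAt {m} {X} b b≤i′ m≤X X≤m+d same = b + X , ≤-trans m≤X (m≤n+m X b) , (begin
    b + X         ≤⟨ +-mono-≤ b≤i′ X≤m+d ⟩
    i′ + (m + d)  ≡⟨ +-comm i′ (m + d) ⟩
    m + d + i′    ≡⟨ +-assoc m d i′ ⟩
    m + (d + i′)  ∎) , same
    where open ≤-Reasoning

  occurrence : ∀ m → ∃ λ j → m ≤ j × j ≤ m + (d + i′) × SameFactor s i j n
  occurrence m with q , m≤X , X≤m+d ← multiple-in-window m d {{d≢0}}
               with s (d * q) in s[X]
  ... | false = occurrenceAt i (m≤m+n i _) m≤X X≤m+d λ k k<n →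
    trans (xorShift-factor s i (shift q) (+-monoˡ-≤ n (m≤m+n i _)) k k<n)
          (trans (cong (s (i + k) xor_) s[X]) (xor-identityʳ _))
  ... | true = occurrenceAt i′ ≤-refl m≤X X≤m+d λ k k<n → begin
    s (i′ + d * q + k)            ≡⟨ xorShift-factor s i′ (shift q) ≤-refl k k<n ⟩
    s (i′ + k) xor s (d * q)      ≡⟨ cong₂ _xor_ (flipped k k<n) s[X] ⟩
    (s (i + k) xor true) xor true ≡⟨ xor-true-twice (s (i + k)) ⟩
    s (i + k)                     ∎
    where
    open ≡-Reasoning
    xor-true-twice : ∀ b → (b xor true) xor true ≡ b
    xor-true-twice false = refl
    xor-true-twice true = refl

module ThreeHalves (c₁ c₂ : Bool) (e : ℕ) (e≤1 : e ≤ 1) where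

  digit : Fin 3 → Bool
  digit zero = false
  digit (suc zero) = c₁
  digit (suc (suc zero)) = c₂

  offset : Fin 3 → ℕ
  offset zero = 0
  offset (suc zero) = 0
  offset (suc (suc zero)) = e

  parent : ℕ → Fin 3 → ℕ
  parent k r = 2 * k + offset r

  rule : Word → ℕ → Fin 3 → Bool
  rule s k r = digit r xor s (parent k r)

  record Obeys (s : Word) : Set where
    field
      starts-with-0 : s 0 ≡ false
      rule-holds : ∀ k r → s (3 * k + toℕ r) ≡ rule s k r

  parent-bound : ∀ {j} k r → 3 * k + toℕ r ≤ suc j → parent k r ≤ j
  parent-bound zero zero _ = z≤n
  parent-bound (suc k) zero 3k≤1+j = s≤s⁻¹ (≤-trans (s≤s (+-monoˡ-≤ 0 (m≤n+m (2 * suc k) k))) 3k≤1+j)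
  parent-bound {j} k (suc r) 3k+r≤1+j = s≤s⁻¹ (begin
    suc (2 * k + offset (suc r)) ≡⟨ +-suc (2 * k) (offset (suc r)) ⟨
    2 * k + suc (offset (suc r)) ≤⟨ +-mono-≤ (*-monoˡ-≤ k (n≤1+n 2)) (offset<toℕ r) ⟩
    3 * k + toℕ (suc r)          ≤⟨ 3k+r≤1+j ⟩
    suc j                        ∎)
    where
    open ≤-Reasoning
    offset<toℕ : ∀ r → offset (suc r) < toℕ (suc r)
    offset<toℕ zero = s≤s z≤n
    offset<toℕ (suc zero) = s≤s e≤1

  module _ {s : Word} (obeys : Obeys s) where
    open Obeys obeys

    s[3m]≡s[2m] : ∀ m → s (3 * m) ≡ s (2 * m)
    s[3m]≡s[2m] m = begin
      s (3 * m)      ≡⟨ cong s (+-identityʳ (3 * m)) ⟨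
      s (3 * m + 0)  ≡⟨ rule-holds m zero ⟩
      s (2 * m + 0)  ≡⟨ cong s (+-identityʳ (2 * m)) ⟩
      s (2 * m)      ∎
      where open ≡-Reasoning

    xorShift : ∀ j E → XorShift s j (3 ^ j * E)
    xorShift zero E zero z≤n = cong (_xor s (3 ^ 0 * E)) (sym starts-with-0)
    xorShift (suc j) E n n≤1+j with divMod3 n | divMod3-correct n
    ... | k , r | refl = begin
      s (3 * k + toℕ r + 3 ^ suc j * E)                     ≡⟨ cong s (regroup k (toℕ r) (3 ^ j) E) ⟩
      s (3 * (k + 3 ^ j * E) + toℕ r)                       ≡⟨ rule-holds (k + 3 ^ j * E) r ⟩
      digit r xor s (parent (k + 3 ^ j * E) r)              ≡⟨ cong (λ x → digit r xor s x) (double k (offset r) (3 ^ j) E) ⟩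
      digit r xor s (parent k r + 3 ^ j * (2 * E))          ≡⟨ cong (digit r xor_) (xorShift j (2 * E) (parent k r) (parent-bound k r n≤1+j)) ⟩
      digit r xor (s (parent k r) xor s (3 ^ j * (2 * E)))  ≡⟨ xor-assoc (digit r) _ _ ⟨
      rule s k r xor s (3 ^ j * (2 * E))                    ≡⟨ cong₂ _xor_ (rule-holds k r) s[3^[1+j]*E] ⟨
      s (3 * k + toℕ r) xor s (3 ^ suc j * E)               ∎
      where
      open ≡-Reasoning
      regroup : ∀ k r a E → 3 * k + r + 3 * a * E ≡ 3 * (k + a * E) + r
      regroup = solve-∀
      double : ∀ k o a E → 2 * (k + a * E) + o ≡ 2 * k + o + a * (2 * E)
      double = solve-∀
      s[3^[1+j]*E] : s (3 ^ suc j * E) ≡ s (3 ^ j * (2 * E))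
      s[3^[1+j]*E] = begin
        s (3 * 3 ^ j * E)    ≡⟨ cong s (*-assoc 3 (3 ^ j) E) ⟩
        s (3 * (3 ^ j * E))  ≡⟨ s[3m]≡s[2m] (3 ^ j * E) ⟩
        s (2 * (3 ^ j * E))  ≡⟨ cong s (*-Props.x∙yz≈y∙xz 2 (3 ^ j) E) ⟩
        s (3 ^ j * (2 * E))  ∎

    s[2^j*F]≡s[3^j*F] : ∀ j F → s (2 ^ j * F) ≡ s (3 ^ j * F)
    s[2^j*F]≡s[3^j*F] zero F = refl
    s[2^j*F]≡s[3^j*F] (suc j) F = begin
      s (2 * 2 ^ j * F)      ≡⟨ cong s (*-Props.xy∙z≈y∙xz 2 (2 ^ j) F) ⟩
      s (2 ^ j * (2 * F))    ≡⟨ s[2^j*F]≡s[3^j*F] j (2 * F) ⟩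
      s (3 ^ j * (2 * F))    ≡⟨ cong s (*-Props.x∙yz≈y∙xz (3 ^ j) 2 F) ⟩
      s (2 * (3 ^ j * F))    ≡⟨ s[3m]≡s[2m] (3 ^ j * F) ⟨
      s (3 * (3 ^ j * F))    ≡⟨ cong s (*-assoc 3 (3 ^ j) F) ⟨
      s (3 * 3 ^ j * F)      ∎
      where open ≡-Reasoning

    -- One of 3^J x and n₀ + 3^J x carries a 1, and the latter is a multiple 2^j y.
    ∃s[3^j*E]≡1 : ∀ {n₀} → s n₀ ≡ true → ∀ j → ∃ λ E → s (3 ^ j * E) ≡ true
    ∃s[3^j*E]≡1 {n₀} s[n₀]≡1 j with x , y , n₀+P≡2^j*y ← ∃n+3^2^[n+j]*x≡2^j*y n₀ j
                               with s (3 ^ (2 ^ (n₀ + j)) * x) in s[P]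
    ... | true = 3 ^ (J ∸ j) * x , (begin
      s (3 ^ j * (3 ^ (J ∸ j) * x))  ≡⟨ cong s (*-assoc (3 ^ j) _ x) ⟨
      s (3 ^ j * 3 ^ (J ∸ j) * x)    ≡⟨ cong (λ a → s (a * x)) (^-distribˡ-+-* 3 j (J ∸ j)) ⟨
      s (3 ^ (j + (J ∸ j)) * x)      ≡⟨ cong (λ i → s (3 ^ i * x)) (m+[n∸m]≡n (j≤J)) ⟩
      s (3 ^ J * x)                  ≡⟨ s[P] ⟩
      true                           ∎)
      where
      open ≡-Reasoning
      J : ℕ
      J = 2 ^ (n₀ + j)
      j≤J : j ≤ J
      j≤J = ≤-trans (m≤n+m j n₀) (<⇒≤ (n<2^n (n₀ + j)))
    ... | false = y , (begin
      s (3 ^ j * y)                    ≡⟨ s[2^j*F]≡s[3^j*F] j y ⟨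
      s (2 ^ j * y)                    ≡⟨ cong s n₀+P≡2^j*y ⟨
      s (n₀ + 3 ^ (2 ^ (n₀ + j)) * x)  ≡⟨ xorShift (2 ^ (n₀ + j)) x n₀ n₀≤J ⟩
      s n₀ xor s (3 ^ (2 ^ (n₀ + j)) * x) ≡⟨ cong₂ _xor_ s[n₀]≡1 s[P] ⟩
      true                             ∎)
      where
      open ≡-Reasoning
      n₀≤J : n₀ ≤ 2 ^ (n₀ + j)
      n₀≤J = ≤-trans (m≤m+n n₀ j) (<⇒≤ (n<2^n (n₀ + j)))

    uniformlyRecurrent : ∀ {n₀} → s n₀ ≡ true → UniformlyRecurrent s
    uniformlyRecurrent s[n₀]≡1 = xorShifts⇒uniformlyRecurrent s λ j →
      3 ^ j , m^n≢0 3 j , xorShift j , ∃s[3^j*E]≡1 s[n₀]≡1 j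

  -- approx f is exact on positions ≤ f, since parents precede their children.
  approx : ℕ → Word
  approx zero _ = false
  approx (suc f) n = rule (approx f) (proj₁ (divMod3 n)) (proj₂ (divMod3 n))

  approx-stable : ∀ f g n → n ≤ f → n ≤ g → approx f n ≡ approx g n
  approx-stable zero zero zero _ _ = refl
  approx-stable zero (suc g) zero _ _ = approx-stable zero g zero z≤n z≤n
  approx-stable (suc f) zero zero _ _ = approx-stable f zero zero z≤n z≤n
  approx-stable (suc f) (suc g) n n≤1+f n≤1+g with divMod3 n | divMod3-correct n
  ... | k , r | refl = cong (digit r xor_)
    (approx-stable f g (parent k r) (parent-bound k r n≤1+f) (parent-bound k r n≤1+g))

  fixedWord : Word
  fixedWord n = approx (suc n) n

  fixedWord-obeys : Obeys fixedWord
  fixedWord-obeys = record { starts-with-0 = refl ; rule-holds = rule-holds }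
    where
    rule-holds : ∀ k r → fixedWord (3 * k + toℕ r) ≡ rule fixedWord k r
    rule-holds k r = begin
      approx (suc n) n                  ≡⟨ cong (λ (k , r) → rule (approx n) k r) (divMod3-3k+r k r) ⟩
      digit r xor approx n (parent k r) ≡⟨ cong (digit r xor_) (approx-stable n (suc p) p (parent-bound k r (n≤1+n n)) (n≤1+n p)) ⟩
      rule fixedWord k r                ∎
      where
      open ≡-Reasoning
      n p : ℕ
      n = 3 * k + toℕ r
      p = parent k r

module T32 = ThreeHalves false true 1 ≤-refl
module Dekking = ThreeHalves true false 0 z≤n

IsT32⇒obeys : ∀ t → IsT32 t → T32.Obeys t
IsT32⇒obeys t (t₀≡0 , relations) = record { starts-with-0 = t₀≡0 ; rule-holds = rule-holds }
  where
  rule-holds : ∀ k r → t (3 * k + toℕ r) ≡ T32.rule t k r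
  rule-holds k zero = begin
    t (3 * k + 0)  ≡⟨ cong t (+-identityʳ (3 * k)) ⟩
    t (3 * k)      ≡⟨ proj₁ (relations k) ⟩
    t (2 * k)      ≡⟨ cong t (+-identityʳ (2 * k)) ⟨
    t (2 * k + 0)  ∎
    where open ≡-Reasoning
  rule-holds k (suc zero) = trans (proj₁ (proj₂ (relations k))) (cong t (sym (+-identityʳ (2 * k))))
  rule-holds k (suc (suc zero)) = proj₂ (proj₂ (relations k))

obeys⇒IsT32 : ∀ {t} → T32.Obeys t → IsT32 t
obeys⇒IsT32 {t} obeys = starts-with-0 , λ n →
  T32.s[3m]≡s[2m] obeys n ,
  trans (rule-holds n (suc zero)) (cong t (+-identityʳ (2 * n))) ,
  rule-holds n (suc (suc zero))
  where open T32.Obeys obeys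

IsT32⇒t₂≡1 : ∀ t → IsT32 t → t 2 ≡ true
IsT32⇒t₂≡1 _ (t₀≡0 , relations) =
  trans (proj₂ (proj₂ (relations 0))) (cong not (trans (proj₁ (proj₂ (relations 0))) t₀≡0))

β≡digit-xor : ∀ a b r → β a b r ≡ Dekking.digit r xor a
β≡digit-xor false false zero = refl
β≡digit-xor false false (suc zero) = refl
β≡digit-xor false false (suc (suc zero)) = refl
β≡digit-xor false true zero = refl
β≡digit-xor false true (suc zero) = refl
β≡digit-xor false true (suc (suc zero)) = refl
β≡digit-xor true false zero = refl
β≡digit-xor true false (suc zero) = refl
β≡digit-xor true false (suc (suc zero)) = refl
β≡digit-xor true true zero = refl
β≡digit-xor true true (suc zero) = refl
β≡digit-xor true true (suc (suc zero)) = refl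

Dekking-parent≡2k : ∀ k r → Dekking.parent k r ≡ 2 * k
Dekking-parent≡2k k zero = +-identityʳ (2 * k)
Dekking-parent≡2k k (suc zero) = +-identityʳ (2 * k)
Dekking-parent≡2k k (suc (suc zero)) = +-identityʳ (2 * k)

β-block≡rule : ∀ x k r → β (x (2 * k)) (x (2 * k + 1)) r ≡ Dekking.rule x k r
β-block≡rule x k r = begin
  β (x (2 * k)) (x (2 * k + 1)) r          ≡⟨ β≡digit-xor _ _ r ⟩
  Dekking.digit r xor x (2 * k)            ≡⟨ cong (λ i → Dekking.digit r xor x i) (Dekking-parent≡2k k r) ⟨
  Dekking.digit r xor x (Dekking.parent k r) ∎
  where open ≡-Reasoning

IsDekking⇒obeys : ∀ x → IsDekking x → Dekking.Obeys x
IsDekking⇒obeys x (x₀≡0 , blocks) = record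
  { starts-with-0 = x₀≡0 ; rule-holds = λ k r → trans (blocks k r) (β-block≡rule x k r) }

obeys⇒IsDekking : ∀ {x} → Dekking.Obeys x → IsDekking x
obeys⇒IsDekking {x} obeys = starts-with-0 , λ k r → trans (rule-holds k r) (sym (β-block≡rule x k r))
  where open Dekking.Obeys obeys

IsDekking⇒x₁≡1 : ∀ x → IsDekking x → x 1 ≡ true
IsDekking⇒x₁≡1 _ (x₀≡0 , blocks) = trans (blocks 0 (suc zero)) (trans (β≡digit-xor _ _ (suc zero)) (cong not x₀≡0))

corollary13 : (∃ λ t → IsT32 t × (∀ s → IsT32 s → UniformlyRecurrent s))
    × (∃ λ t → IsDekking t × (∀ s → IsDekking s → UniformlyRecurrent s))
corollary13 =
  ( T32.fixedWord , obeys⇒IsT32 T32.fixedWord-obeys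
  , λ t isT32 → T32.uniformlyRecurrent (IsT32⇒obeys t isT32) (IsT32⇒t₂≡1 t isT32))
  , ( Dekking.fixedWord , obeys⇒IsDekking Dekking.fixedWord-obeys
    , λ x isDekking → Dekking.uniformlyRecurrent (IsDekking⇒obeys x isDekking) (IsDekking⇒x₁≡1 x isDekking))
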